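{- There are two trivial automorphisms $\alpha$ and $\beta$ of $\mathcal P(\mathbb N)/\mathrm{Fin}$ such that $\mathfrak A_\alpha$ and $\mathfrak A_\beta$ are bi-embeddable (so that $\mathrm{Th}_\exists(\mathfrak A_\alpha)=\mathrm{Th}_\exists(\mathfrak A_\beta)$), but $\mathrm{Th}(\mathfrak A_\alpha)\neq\mathrm{Th}(\mathfrak A_\beta)$.
   Context: An almost permutation of $\mathbb N$ is a bijection $f$ between cofinite subsets of $\mathbb N$; the induced automorphism $\alpha_f([A]_{\mathrm{Fin}})=[f[A]]_{\mathrm{Fin}}$ of $\mathcal P(\mathbb N)/\mathrm{Fin}$ is called trivial. $\mathfrak A_\alpha=\langle\mathcal P(\mathbb N)/\mathrm{Fin},\alpha\rangle$ in the language of Boolean algebras plus a unary function symbol interpreted by $\alpha$. An embedding $\mathfrak A_\alpha\to\mathfrak A_\beta$ is an injective Boolean algebra homomorphism $\eta$ with $\eta\circ\alpha=\beta\circ\eta$; bi-embeddable means each embeds in the other. $\mathrm{Th}$ and $\mathrm{Th}_\exists$ denote the full first-order and the existential theory. -}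

module Defs where

open import Data.Nat using (ℕ; _≤_)
open import Data.Bool using (Bool; true; false; _∧_; _∨_; not)
open import Data.Fin using (Fin; zero; suc)
open import Data.Product using (Σ; ∃; _×_; _,_)
open import Data.Sum using (_⊎_)
open import Data.Empty using (⊥)
open import Relation.Nullary using (¬_)
open import Relation.Binary.PropositionalEquality using (_≡_)
open import Function.Bundles using (_⇔_)

-- P(ℕ) and the ideal Fin.  Subsets of ℕ are characteristic functions
-- (under excluded middle, which the main statement assumes, these are
-- exactly the subsets of ℕ).

Subset : Set
Subset = ℕ → Bool

Finite : Subset → Set
Finite A = ∃ λ n → ∀ m → n ≤ m → A m ≡ false

Cofinite : Subset → Set
Cofinite A = ∃ λ n → ∀ m → n ≤ m → A m ≡ true

_=*_ : Subset → Subset → Set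
A =* B = ∃ λ n → ∀ m → n ≤ m → A m ≡ B m

_⊔ˢ_ : Subset → Subset → Subset
(A ⊔ˢ B) m = A m ∨ B m

_⊓ˢ_ : Subset → Subset → Subset
(A ⊓ˢ B) m = A m ∧ B m

∁ˢ : Subset → Subset
∁ˢ A m = not (A m)

∅ˢ : Subset
∅ˢ _ = false

ℕˢ : Subset
ℕˢ _ = true

record AlmostPerm : Set where
  field
    dom       : Subset
    cod       : Subset
    dom-cofin : Cofinite dom
    cod-cofin : Cofinite cod
    fun       : ℕ → ℕ
    inv       : ℕ → ℕ
    fun-maps  : ∀ x → dom x ≡ true → cod (fun x) ≡ true
    inv-maps  : ∀ y → cod y ≡ true → dom (inv y) ≡ true
    inv-fun   : ∀ x → dom x ≡ true → inv (fun x) ≡ x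
    fun-inv   : ∀ y → cod y ≡ true → fun (inv y) ≡ y

-- The image f[A] = { fun x | x ∈ A ∩ dom } = { y ∈ cod | inv y ∈ A }.
-- The trivial automorphism α_f is [A] ↦ [f[A]].
image : AlmostPerm → Subset → Subset
image f A y = AlmostPerm.cod f y ∧ A (AlmostPerm.inv f y)

-- First-order language of Boolean algebras plus a unary function
-- symbol σ (interpreted by the automorphism).  Variables are de Bruijn.

data Term (n : ℕ) : Set where
  var  : Fin n → Term n
  _⊔ₜ_ : Term n → Term n → Term n
  _⊓ₜ_ : Term n → Term n → Term n
  ∁ₜ   : Term n → Term n
  𝟘ₜ   : Term n
  𝟙ₜ   : Term n
  σₜ   : Term n → Term n

data Formula : ℕ → Set where
  _≐_  : ∀ {n} → Term n → Term n → Formula n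
  ¬ᶠ   : ∀ {n} → Formula n → Formula n
  _∧ᶠ_ : ∀ {n} → Formula n → Formula n → Formula n
  _∨ᶠ_ : ∀ {n} → Formula n → Formula n → Formula n
  ∀ᶠ   : ∀ {n} → Formula (ℕ.suc n) → Formula n
  ∃ᶠ   : ∀ {n} → Formula (ℕ.suc n) → Formula n

Sentence : Set
Sentence = Formula 0

-- Interpretation in 𝔄_{α_f} = ⟨P(ℕ)/Fin, α_f⟩: elements of the quotient
-- are represented by subsets, equality is =*.

extend : ∀ {n} → Subset → (Fin n → Subset) → Fin (ℕ.suc n) → Subset
extend A ρ zero    = A
extend A ρ (suc i) = ρ i

⟦_⟧ₜ : ∀ {n} → Term n → AlmostPerm → (Fin n → Subset) → Subset
⟦ var i ⟧ₜ  f ρ = ρ i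
⟦ s ⊔ₜ t ⟧ₜ f ρ = ⟦ s ⟧ₜ f ρ ⊔ˢ ⟦ t ⟧ₜ f ρ
⟦ s ⊓ₜ t ⟧ₜ f ρ = ⟦ s ⟧ₜ f ρ ⊓ˢ ⟦ t ⟧ₜ f ρ
⟦ ∁ₜ t ⟧ₜ   f ρ = ∁ˢ (⟦ t ⟧ₜ f ρ)
⟦ 𝟘ₜ ⟧ₜ     f ρ = ∅ˢ
⟦ 𝟙ₜ ⟧ₜ     f ρ = ℕˢ
⟦ σₜ t ⟧ₜ   f ρ = image f (⟦ t ⟧ₜ f ρ)

Sat : AlmostPerm → ∀ {n} → (Fin n → Subset) → Formula n → Set
Sat f ρ (s ≐ t)   = ⟦ s ⟧ₜ f ρ =* ⟦ t ⟧ₜ f ρ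
Sat f ρ (¬ᶠ φ)    = ¬ Sat f ρ φ
Sat f ρ (φ ∧ᶠ ψ)  = Sat f ρ φ × Sat f ρ ψ
Sat f ρ (φ ∨ᶠ ψ)  = Sat f ρ φ ⊎ Sat f ρ ψ
Sat f ρ (∀ᶠ φ)    = ∀ (A : Subset) → Sat f (extend A ρ) φ
Sat f ρ (∃ᶠ φ)    = Σ Subset λ A → Sat f (extend A ρ) φ

noVars : Fin 0 → Subset
noVars ()

Models : AlmostPerm → Sentence → Set
Models f φ = Sat f noVars φ

SameTheory : AlmostPerm → AlmostPerm → Set
SameTheory f g = ∀ (φ : Sentence) → Models f φ ⇔ Models g φ

-- Embeddings 𝔄_{α_f} → 𝔄_{α_g}: a map η on P(ℕ)/Fin (given by a map on
-- representatives respecting =*) which is an injective Boolean algebra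
-- homomorphism commuting with the automorphisms.

record Embedding (f g : AlmostPerm) : Set where
  field
    η         : Subset → Subset
    η-cong    : ∀ A B → A =* B → η A =* η B
    η-inj     : ∀ A B → η A =* η B → A =* B
    η-⊔       : ∀ A B → η (A ⊔ˢ B) =* (η A ⊔ˢ η B)
    η-⊓       : ∀ A B → η (A ⊓ˢ B) =* (η A ⊓ˢ η B)
    η-∁       : ∀ A → η (∁ˢ A) =* ∁ˢ (η A)
    η-𝟘       : η ∅ˢ =* ∅ˢ
    η-𝟙       : η ℕˢ =* ℕˢ
    η-commute : ∀ A → η (image f A) =* image g (η A)

BiEmbeddable : AlmostPerm → AlmostPerm → Set
BiEmbeddable f g = Embedding f g × Embedding g f

-- α and β are induced by periodic permutations of ℕ: on each block of 5 consecutive numbers α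
-- has a fixed point and a 4-cycle; on each block of 7, β has a fixed point, a 2-cycle and a
-- 4-cycle. Pulling subsets back along an equivariant, finite-to-one surjection between the
-- underlying actions is an embedding, and such surjections exist in both directions: a 7-block
-- of β onto a 5-block of α (fixed point and 2-cycle onto the fixed point), and a 10-block of α
-- onto a 7-block of β (one 4-cycle wrapping twice around the 2-cycle). The theories are
-- separated by "some a ≠ 0 is disjoint from σa and fixed pointwise by σ²", which β satisfies
-- with a one point of each 2-cycle. It fails for α: colouring each block {1,2} | {0,3,4}, every
-- point is fixed by σ or changes colour under σ², so such an a vanishes on both colour classes
-- of moved points, and on the fixed points by disjointness from σa.
module Submission where

open import Defs
open import Axiom.ExcludedMiddle using (ExcludedMiddle)
open import Level using (0ℓ)
open import Data.Product using (Σ; _×_; _,_; ∃; proj₁; proj₂)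
open import Relation.Nullary using (¬_)
open import Data.Bool using (Bool; true; false; _∧_; not)
open import Data.Bool.Properties using (∧-zeroʳ; ∧-identityʳ; ∧-idem) renaming (_≟_ to _≟ᵇ_)
open import Data.Nat using (ℕ; _+_; _*_; _≤_; _⊔_; NonZero)
open import Data.Nat.Properties using (≤-trans; m≤m*n; m≤n+m; m⊔n≤o⇒m≤o; m⊔n≤o⇒n≤o; m*n≢0)
open import Data.Nat.DivMod using (_/_; _%_; _mod_; _divMod_; DivMod; m%n<n; m<n⇒m%n≡m; m<n⇒m/n≡0;
  [m+kn]%n≡m%n; +-distrib-/-∣ʳ; m*n/n≡m; /-monoˡ-≤)
open import Data.Nat.Divisibility using (n∣m*n)
open import Data.Nat.Tactic.RingSolver using (solve-∀)
open import Data.Fin using (Fin; toℕ; combine; quotient; remainder)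
open import Data.Fin.Patterns using (0F; 1F; 2F; 3F; 4F; 5F; 6F; 7F; 8F; 9F)
open import Data.Fin.Properties using (toℕ-injective; toℕ-fromℕ<; toℕ<n; toℕ-combine;
  remQuot-combine; combine-remQuot; all?; _≟_)
open import Data.Fin.Permutation using (Permutation′; permutation; _⟨$⟩ʳ_; _⟨$⟩ˡ_; inverseˡ; inverseʳ)
open import Data.Sum using (_⊎_; inj₁; inj₂)
open import Function using (_∘_; case_of_; Equivalence)
open import Relation.Nullary.Decidable using (from-yes; _⊎-dec_; _→-dec_)
open import Relation.Binary.PropositionalEquality using (_≡_; refl; sym; trans; cong; cong₂; subst;
  module ≡-Reasoning)
open ≡-Reasoning

mod-unique : ∀ {k} .{{_ : NonZero k}} (r : Fin k) q → (toℕ r + q * k) mod k ≡ r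
mod-unique {k} r q = toℕ-injective (begin
  toℕ ((toℕ r + q * k) mod k) ≡⟨ toℕ-fromℕ< (m%n<n (toℕ r + q * k) k) ⟩
  (toℕ r + q * k) % k         ≡⟨ [m+kn]%n≡m%n (toℕ r) q k ⟩
  toℕ r % k                   ≡⟨ m<n⇒m%n≡m (toℕ<n r) ⟩
  toℕ r                       ∎)

div-unique : ∀ {k} .{{_ : NonZero k}} (r : Fin k) q → (toℕ r + q * k) / k ≡ q
div-unique {k} r q = begin
  (toℕ r + q * k) / k   ≡⟨ +-distrib-/-∣ʳ (toℕ r) (n∣m*n q) ⟩
  toℕ r / k + q * k / k ≡⟨ cong₂ _+_ (m<n⇒m/n≡0 (toℕ<n r)) (m*n/n≡m q k) ⟩
  q                     ∎

blockwise : ∀ {k l} .{{_ : NonZero k}} → (Fin k → Fin l) → ℕ → ℕ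
blockwise {k} {l} ρ n = toℕ (ρ (n mod k)) + n / k * l

blockwise-mod : ∀ {k l} .{{_ : NonZero k}} .{{_ : NonZero l}} (ρ : Fin k → Fin l) n →
                blockwise ρ n mod l ≡ ρ (n mod k)
blockwise-mod {k} ρ n = mod-unique (ρ (n mod k)) (n / k)

blockwise-decomposed : ∀ {k l} .{{_ : NonZero k}} (ρ : Fin k → Fin l) r q →
                       blockwise ρ (toℕ r + q * k) ≡ toℕ (ρ r) + q * l
blockwise-decomposed {l = l} ρ r q =
  cong₂ (λ r′ q′ → toℕ (ρ r′) + q′ * l) (mod-unique r q) (div-unique r q)

blockwise-cong : ∀ {k l} .{{_ : NonZero k}} {ρ ρ′ : Fin k → Fin l} → (∀ r → ρ r ≡ ρ′ r) →
                 ∀ n → blockwise ρ n ≡ blockwise ρ′ n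
blockwise-cong {k} {l} ρ≗ρ′ n = cong (λ r → toℕ r + n / k * l) (ρ≗ρ′ (n mod k))

blockwise-∘ : ∀ {k l m} .{{_ : NonZero k}} .{{_ : NonZero l}} (σ : Fin l → Fin m) (ρ : Fin k → Fin l) n →
              blockwise σ (blockwise ρ n) ≡ blockwise (σ ∘ ρ) n
blockwise-∘ {k} σ ρ n = blockwise-decomposed σ (ρ (n mod k)) (n / k)

blockwise-fixes : ∀ {k} .{{_ : NonZero k}} (ρ : Fin k → Fin k) n → ρ (n mod k) ≡ n mod k → blockwise ρ n ≡ n
blockwise-fixes {k} ρ n fixes = begin
  toℕ (ρ (n mod k)) + n / k * k ≡⟨ cong (λ r → toℕ r + n / k * k) fixes ⟩
  toℕ (n mod k) + n / k * k     ≡⟨ DivMod.property (n divMod k) ⟨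
  n                             ∎

blockwise-inverse : ∀ {k l} .{{_ : NonZero k}} .{{_ : NonZero l}} (σ : Fin l → Fin k) (ρ : Fin k → Fin l) →
                    (∀ r → σ (ρ r) ≡ r) →
                    ∀ n → blockwise σ (blockwise ρ n) ≡ n
blockwise-inverse {k} σ ρ σ∘ρ≗id n =
  trans (blockwise-∘ σ ρ n) (blockwise-fixes (σ ∘ ρ) n (σ∘ρ≗id (n mod k)))

Divergent : (ℕ → ℕ) → Set
Divergent h = ∀ n → ∃ λ N → ∀ m → N ≤ m → n ≤ h m

blockwise-divergent : ∀ {k l} .{{_ : NonZero k}} .{{_ : NonZero l}} (ρ : Fin k → Fin l) → Divergent (blockwise ρ)
blockwise-divergent {k} {l} ρ n = n * k , λ m n*k≤m →
  ≤-trans (subst (_≤ m / k) (m*n/n≡m n k) (/-monoˡ-≤ k n*k≤m))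
          (≤-trans (m≤m*n (m / k) l) (m≤n+m (m / k * l) _))

regroup : ∀ {k l} j → (Fin k → Fin l) → Fin (j * k) → Fin (j * l)
regroup {k} j ρ x = combine (quotient {j} k x) (ρ (remainder {j} k x))

regroup-inverse : ∀ {k} j (σ ρ : Fin k → Fin k) → (∀ r → σ (ρ r) ≡ r) → ∀ x → regroup j σ (regroup j ρ x) ≡ x
regroup-inverse {k} j σ ρ σ∘ρ≗id x = begin
  regroup j σ (regroup j ρ x) ≡⟨ cong (λ (i , p) → combine i (σ p)) (remQuot-combine i (ρ p)) ⟩
  combine i (σ (ρ p))         ≡⟨ cong (combine i) (σ∘ρ≗id p) ⟩
  combine i p                 ≡⟨ combine-remQuot {j} k x ⟩
  x                           ∎
  where
  i = quotient {j} k x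
  p = remainder {j} k x

blockwise-regroup : ∀ {k l} j .{{_ : NonZero j}} .{{_ : NonZero k}} .{{_ : NonZero l}} (ρ : Fin k → Fin l) n →
                    blockwise ρ n ≡ blockwise {{m*n≢0 j k}} (regroup j ρ) n
blockwise-regroup {k} {l} j ρ n = begin
  blockwise ρ n                                ≡⟨ cong (blockwise ρ) decomposition ⟩
  blockwise ρ (toℕ p + (toℕ i + Q * j) * k)    ≡⟨ blockwise-decomposed ρ p (toℕ i + Q * j) ⟩
  toℕ (ρ p) + (toℕ i + Q * j) * l              ≡⟨ regroup-identity l (toℕ i) (toℕ (ρ p)) Q j ⟨
  l * toℕ i + toℕ (ρ p) + Q * (j * l)          ≡⟨ cong (_+ Q * (j * l)) (toℕ-combine i (ρ p)) ⟨
  toℕ (regroup j ρ x) + Q * (j * l)            ∎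
  where
  instance _ = m*n≢0 j k
  x = n mod (j * k)
  i = quotient {j} k x
  p = remainder {j} k x
  Q = n / (j * k)
  regroup-identity : ∀ k i t Q j → k * i + t + Q * (j * k) ≡ t + (i + Q * j) * k
  regroup-identity = solve-∀
  decomposition : n ≡ toℕ p + (toℕ i + Q * j) * k
  decomposition = begin
    n                                ≡⟨ DivMod.property (n divMod (j * k)) ⟩
    toℕ x + Q * (j * k)              ≡⟨ cong (λ y → toℕ y + Q * (j * k)) (combine-remQuot {j} k x) ⟨
    toℕ (combine i p) + Q * (j * k)  ≡⟨ cong (_+ Q * (j * k)) (toℕ-combine i p) ⟩
    k * toℕ i + toℕ p + Q * (j * k)  ≡⟨ regroup-identity k (toℕ i) (toℕ p) Q j ⟩
    toℕ p + (toℕ i + Q * j) * k      ∎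

periodic : ∀ {k} .{{_ : NonZero k}} → (Fin k → Bool) → Subset
periodic {k} b n = b (n mod k)

periodic-blockwise : ∀ {k l} .{{_ : NonZero k}} .{{_ : NonZero l}} (b : Fin l → Bool) (ρ : Fin k → Fin l) n →
                     periodic b (blockwise ρ n) ≡ b (ρ (n mod k))
periodic-blockwise b ρ n = cong b (blockwise-mod ρ n)

periodic-infinite : ∀ {k} .{{_ : NonZero k}} (b : Fin k → Bool) r → b r ≡ true → ¬ (periodic b =* ∅ˢ)
periodic-infinite {k} b r br≡true (N , null) = case true≡false of λ ()
  where
  m = toℕ r + N * k
  true≡false : true ≡ false
  true≡false = begin
    true            ≡⟨ br≡true ⟨
    b r             ≡⟨ cong b (mod-unique r N) ⟨
    periodic b m    ≡⟨ null m (≤-trans (m≤m*n N k) (m≤n+m (N * k) (toℕ r))) ⟩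
    false           ∎

blockPerm : ∀ {k} .{{_ : NonZero k}} → Permutation′ k → AlmostPerm
blockPerm π = record
  { dom       = ℕˢ
  ; cod       = ℕˢ
  ; dom-cofin = 0 , λ _ _ → refl
  ; cod-cofin = 0 , λ _ _ → refl
  ; fun       = blockwise (π ⟨$⟩ʳ_)
  ; inv       = blockwise (π ⟨$⟩ˡ_)
  ; fun-maps  = λ _ _ → refl
  ; inv-maps  = λ _ _ → refl
  ; inv-fun   = λ x _ → blockwise-inverse (π ⟨$⟩ˡ_) (π ⟨$⟩ʳ_) (λ _ → inverseˡ π) x
  ; fun-inv   = λ y _ → blockwise-inverse (π ⟨$⟩ʳ_) (π ⟨$⟩ˡ_) (λ _ → inverseʳ π) y
  }

regroupPerm : ∀ {k} j → Permutation′ k → Permutation′ (j * k)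
regroupPerm j π = permutation (regroup j (π ⟨$⟩ʳ_)) (regroup j (π ⟨$⟩ˡ_))
  (regroup-inverse j (π ⟨$⟩ʳ_) (π ⟨$⟩ˡ_) (λ _ → inverseʳ π))
  (regroup-inverse j (π ⟨$⟩ˡ_) (π ⟨$⟩ʳ_) (λ _ → inverseˡ π))

image-regroupPerm : ∀ {k} j .{{_ : NonZero j}} .{{_ : NonZero k}} (π : Permutation′ k) A y →
                    image (blockPerm π) A y ≡ image (blockPerm {{m*n≢0 j k}} (regroupPerm j π)) A y
image-regroupPerm j π A y = cong A (blockwise-regroup j (π ⟨$⟩ˡ_) y)

pullbackEmbedding : (f g : AlmostPerm) (h s : ℕ → ℕ) → (∀ y → h (s y) ≡ y) → Divergent h → Divergent s →
                    (∀ A m → image f A (h m) ≡ image g (A ∘ h) m) → Embedding f g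
pullbackEmbedding f g h s h∘s≗id h-divergent s-divergent commutes = record
  { η         = λ A → A ∘ h
  ; η-cong    = λ { A B (n , A≡B) → let (N , h≥n) = h-divergent n in N , λ m N≤m → A≡B (h m) (h≥n m N≤m) }
  ; η-inj     = λ { A B (n , Ah≡Bh) → let (N , s≥n) = s-divergent n in N , λ y N≤y →
                      subst (λ z → A z ≡ B z) (h∘s≗id y) (Ah≡Bh (s y) (s≥n y N≤y)) }
  ; η-⊔       = λ _ _ → 0 , λ _ _ → refl
  ; η-⊓       = λ _ _ → 0 , λ _ _ → refl
  ; η-∁       = λ _ → 0 , λ _ _ → refl
  ; η-𝟘       = 0 , λ _ _ → refl
  ; η-𝟙       = 0 , λ _ _ → refl
  ; η-commute = λ A → 0 , λ m _ → commutes A m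
  }

embedding-resp-image : ∀ {f g g′} → (∀ A y → image g A y ≡ image g′ A y) → Embedding f g → Embedding f g′
embedding-resp-image g≗g′ e = record
  { η         = η
  ; η-cong    = η-cong
  ; η-inj     = η-inj
  ; η-⊔       = η-⊔
  ; η-⊓       = η-⊓
  ; η-∁       = η-∁
  ; η-𝟘       = η-𝟘
  ; η-𝟙       = η-𝟙
  ; η-commute = λ A → let (n , commutes) = η-commute A in
                  n , λ m n≤m → trans (commutes m n≤m) (g≗g′ (η A) m)
  }
  where open Embedding e

blockEmbedding : ∀ {k l} .{{_ : NonZero k}} .{{_ : NonZero l}} (π : Permutation′ k) (τ : Permutation′ l)
                 (ρ : Fin l → Fin k) (σ : Fin k → Fin l) → (∀ r → ρ (σ r) ≡ r) →
                 (∀ r → ρ (τ ⟨$⟩ʳ r) ≡ π ⟨$⟩ʳ ρ r) → Embedding (blockPerm π) (blockPerm τ)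
blockEmbedding π τ ρ σ ρ∘σ≗id equivariant =
  pullbackEmbedding (blockPerm π) (blockPerm τ) (blockwise ρ) (blockwise σ) (blockwise-inverse ρ σ ρ∘σ≗id)
    (blockwise-divergent ρ) (blockwise-divergent σ) (λ A m → cong A (commutes m))
  where
  equivariant⁻¹ : ∀ r → π ⟨$⟩ˡ ρ r ≡ ρ (τ ⟨$⟩ˡ r)
  equivariant⁻¹ r = begin
    π ⟨$⟩ˡ ρ r                    ≡⟨ cong (λ r′ → π ⟨$⟩ˡ ρ r′) (inverseʳ τ) ⟨
    π ⟨$⟩ˡ ρ (τ ⟨$⟩ʳ (τ ⟨$⟩ˡ r))   ≡⟨ cong (π ⟨$⟩ˡ_) (equivariant (τ ⟨$⟩ˡ r)) ⟩
    π ⟨$⟩ˡ (π ⟨$⟩ʳ ρ (τ ⟨$⟩ˡ r))   ≡⟨ inverseˡ π ⟩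
    ρ (τ ⟨$⟩ˡ r)                  ∎
  commutes : ∀ m → blockwise (π ⟨$⟩ˡ_) (blockwise ρ m) ≡ blockwise ρ (blockwise (τ ⟨$⟩ˡ_) m)
  commutes m = begin
    blockwise (π ⟨$⟩ˡ_) (blockwise ρ m)   ≡⟨ blockwise-∘ (π ⟨$⟩ˡ_) ρ m ⟩
    blockwise ((π ⟨$⟩ˡ_) ∘ ρ) m           ≡⟨ blockwise-cong equivariant⁻¹ m ⟩
    blockwise (ρ ∘ (τ ⟨$⟩ˡ_)) m           ≡⟨ blockwise-∘ ρ (τ ⟨$⟩ˡ_) m ⟨
    blockwise ρ (blockwise (τ ⟨$⟩ˡ_) m)   ∎

twoCycleSentence : Sentence
twoCycleSentence =
  ∃ᶠ (¬ᶠ (var 0F ≐ 𝟘ₜ)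
      ∧ᶠ (((σₜ (var 0F) ⊓ₜ var 0F) ≐ 𝟘ₜ)
      ∧ᶠ ∀ᶠ (σₜ (σₜ (var 1F ⊓ₜ var 0F)) ≐ (var 1F ⊓ₜ var 0F))))

blockPerm-twoCycle : ∀ {k} .{{_ : NonZero k}} (π : Permutation′ k) (b : Fin k → Bool) r₀ → b r₀ ≡ true →
                     (∀ r → b (π ⟨$⟩ˡ r) ∧ b r ≡ false) →
                     (∀ r → b r ≡ true → π ⟨$⟩ˡ (π ⟨$⟩ˡ r) ≡ r) →
                     Models (blockPerm π) twoCycleSentence
blockPerm-twoCycle {k} π b r₀ b-r₀ disjoint involutive =
  periodic b , periodic-infinite b r₀ b-r₀
  , (0 , λ m _ → trans (cong (_∧ b (m mod k)) (periodic-blockwise b (π ⟨$⟩ˡ_) m)) (disjoint (m mod k)))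
  , λ B → 0 , λ m _ → invariant B m
  where
  π⁻² : Fin k → Fin k
  π⁻² r = π ⟨$⟩ˡ (π ⟨$⟩ˡ r)
  σ⁻² : ℕ → ℕ
  σ⁻² m = blockwise (π ⟨$⟩ˡ_) (blockwise (π ⟨$⟩ˡ_) m)
  σ⁻²-blockwise : ∀ m → σ⁻² m ≡ blockwise π⁻² m
  σ⁻²-blockwise = blockwise-∘ (π ⟨$⟩ˡ_) (π ⟨$⟩ˡ_)
  π⁻²-injective : ∀ {r r′} → π⁻² r ≡ π⁻² r′ → r ≡ r′
  π⁻²-injective {r} {r′} eq = begin
    r                          ≡⟨ trans (cong (π ⟨$⟩ʳ_) (inverseʳ π)) (inverseʳ π) ⟨
    π ⟨$⟩ʳ (π ⟨$⟩ʳ π⁻² r)      ≡⟨ cong (λ r″ → π ⟨$⟩ʳ (π ⟨$⟩ʳ r″)) eq ⟩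
    π ⟨$⟩ʳ (π ⟨$⟩ʳ π⁻² r′)     ≡⟨ trans (cong (π ⟨$⟩ʳ_) (inverseʳ π)) (inverseʳ π) ⟩
    r′                         ∎
  unmarked-closed : ∀ r → b r ≡ false → b (π⁻² r) ≡ false
  unmarked-closed r b-r with b (π⁻² r) in b-π⁻²r
  ... | false = refl
  ... | true  = trans (sym b-π⁻²r) (trans (cong b (π⁻²-injective (involutive (π⁻² r) b-π⁻²r))) b-r)
  invariant : ∀ B m → (periodic b (σ⁻² m) ∧ B (σ⁻² m)) ≡ (periodic b m ∧ B m)
  invariant B m with b (m mod k) in b-m
  ... | true  = trans (cong (λ n → periodic b n ∧ B n)
                            (trans (σ⁻²-blockwise m) (blockwise-fixes π⁻² m (involutive (m mod k) b-m))))
                     (cong (_∧ B m) b-m)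
  ... | false = cong (_∧ B (σ⁻² m))
                     (trans (cong (periodic b) (σ⁻²-blockwise m))
                            (trans (periodic-blockwise b π⁻² m) (unmarked-closed (m mod k) b-m)))

blockPerm-¬twoCycle : ∀ {k} .{{_ : NonZero k}} (π : Permutation′ k) (b : Fin k → Bool) →
                      (∀ r → π ⟨$⟩ˡ r ≡ r ⊎ b (π ⟨$⟩ˡ (π ⟨$⟩ˡ r)) ≡ not (b r)) →
                      ¬ Models (blockPerm π) twoCycleSentence
blockPerm-¬twoCycle {k} π b fixed-or-recoloured (A , A≠*∅ , (N₀ , disjoint) , invariant) =
  A≠*∅ (N₀ ⊔ N₁ ⊔ N₂ , λ m N≤m →
    let N₀⊔N₁≤m = m⊔n≤o⇒m≤o (N₀ ⊔ N₁) N₂ N≤m in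
    vanishes m (m⊔n≤o⇒m≤o N₀ N₁ N₀⊔N₁≤m) (m⊔n≤o⇒n≤o N₀ N₁ N₀⊔N₁≤m) (m⊔n≤o⇒n≤o (N₀ ⊔ N₁) N₂ N≤m)
             (fixed-or-recoloured (m mod k)))
  where
  π⁻² : Fin k → Fin k
  π⁻² r = π ⟨$⟩ˡ (π ⟨$⟩ˡ r)
  σ⁻¹ σ⁻² : ℕ → ℕ
  σ⁻¹ = blockwise (π ⟨$⟩ˡ_)
  σ⁻² m = σ⁻¹ (σ⁻¹ m)
  colour-σ⁻² : ∀ m → periodic b (σ⁻² m) ≡ b (π⁻² (m mod k))
  colour-σ⁻² m = trans (cong (periodic b) (blockwise-∘ (π ⟨$⟩ˡ_) (π ⟨$⟩ˡ_) m)) (periodic-blockwise b π⁻² m)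
  N₁ N₂ : ℕ
  N₁ = proj₁ (invariant (periodic b))
  N₂ = proj₁ (invariant (∁ˢ (periodic b)))
  vanishes-where-recoloured : ∀ {a a′ c c′} → (a′ ∧ c′) ≡ (a ∧ c) → c ≡ true → c′ ≡ false → a ≡ false
  vanishes-where-recoloured {a} {a′} eq refl refl =
    trans (sym (∧-identityʳ a)) (trans (sym eq) (∧-zeroʳ a′))
  vanishes : ∀ m → N₀ ≤ m → N₁ ≤ m → N₂ ≤ m →
             π ⟨$⟩ˡ (m mod k) ≡ m mod k ⊎ b (π⁻² (m mod k)) ≡ not (b (m mod k)) → A m ≡ false
  vanishes m N₀≤m _ _ (inj₁ fixed) = begin
    A m             ≡⟨ ∧-idem (A m) ⟨
    A m ∧ A m       ≡⟨ cong (λ n → A n ∧ A m) (blockwise-fixes (π ⟨$⟩ˡ_) m fixed) ⟨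
    A (σ⁻¹ m) ∧ A m ≡⟨ disjoint m N₀≤m ⟩
    false           ∎
  vanishes m _ N₁≤m N₂≤m (inj₂ recoloured) with b (m mod k) in b-m
  ... | true  = vanishes-where-recoloured (proj₂ (invariant (periodic b)) m N₁≤m)
                  b-m (trans (colour-σ⁻² m) recoloured)
  ... | false = vanishes-where-recoloured (proj₂ (invariant (∁ˢ (periodic b))) m N₂≤m)
                  (cong not b-m) (cong not (trans (colour-σ⁻² m) recoloured))

cycles-1-4 : Permutation′ 5
cycles-1-4 = permutation to from (from-yes (all? λ r → to (from r) ≟ r)) (from-yes (all? λ r → from (to r) ≟ r))
  where
  to from : Fin 5 → Fin 5
  to 0F = 0F
  to 1F = 2F
  to 2F = 3F
  to 3F = 4F
  to 4F = 1F
  from 0F = 0F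
  from 1F = 4F
  from 2F = 1F
  from 3F = 2F
  from 4F = 3F

cycles-1-2-4 : Permutation′ 7
cycles-1-2-4 = permutation to from (from-yes (all? λ r → to (from r) ≟ r)) (from-yes (all? λ r → from (to r) ≟ r))
  where
  to from : Fin 7 → Fin 7
  to 0F = 0F
  to 1F = 2F
  to 2F = 1F
  to 3F = 4F
  to 4F = 5F
  to 5F = 6F
  to 6F = 3F
  from 0F = 0F
  from 1F = 2F
  from 2F = 1F
  from 3F = 6F
  from 4F = 3F
  from 5F = 4F
  from 6F = 5F

α₁₄ α₁₂₄ : AlmostPerm
α₁₄  = blockPerm cycles-1-4
α₁₂₄ = blockPerm cycles-1-2-4

α₁₄↪α₁₂₄ : Embedding α₁₄ α₁₂₄
α₁₄↪α₁₂₄ = blockEmbedding cycles-1-4 cycles-1-2-4 block₇↠block₅ block₅↣block₇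
  (from-yes (all? λ r → block₇↠block₅ (block₅↣block₇ r) ≟ r))
  (from-yes (all? λ r → block₇↠block₅ (cycles-1-2-4 ⟨$⟩ʳ r) ≟ cycles-1-4 ⟨$⟩ʳ block₇↠block₅ r))
  where
  block₇↠block₅ : Fin 7 → Fin 5
  block₇↠block₅ 0F = 0F
  block₇↠block₅ 1F = 0F
  block₇↠block₅ 2F = 0F
  block₇↠block₅ 3F = 1F
  block₇↠block₅ 4F = 2F
  block₇↠block₅ 5F = 3F
  block₇↠block₅ 6F = 4F
  block₅↣block₇ : Fin 5 → Fin 7
  block₅↣block₇ 0F = 0F
  block₅↣block₇ 1F = 3F
  block₅↣block₇ 2F = 4F
  block₅↣block₇ 3F = 5F
  block₅↣block₇ 4F = 6F

α₁₂₄↪α₁₄ : Embedding α₁₂₄ α₁₄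
α₁₂₄↪α₁₄ = embedding-resp-image (λ A y → sym (image-regroupPerm 2 cycles-1-4 A y))
  (blockEmbedding cycles-1-2-4 cycles-1-4-twice block₁₀↠block₇ block₇↣block₁₀
    (from-yes (all? λ r → block₁₀↠block₇ (block₇↣block₁₀ r) ≟ r))
    (from-yes (all? λ r → block₁₀↠block₇ (cycles-1-4-twice ⟨$⟩ʳ r) ≟ cycles-1-2-4 ⟨$⟩ʳ block₁₀↠block₇ r)))
  where
  cycles-1-4-twice : Permutation′ 10
  cycles-1-4-twice = regroupPerm 2 cycles-1-4
  block₁₀↠block₇ : Fin 10 → Fin 7
  block₁₀↠block₇ 0F = 0F
  block₁₀↠block₇ 1F = 1F
  block₁₀↠block₇ 2F = 2F
  block₁₀↠block₇ 3F = 1F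
  block₁₀↠block₇ 4F = 2F
  block₁₀↠block₇ 5F = 0F
  block₁₀↠block₇ 6F = 3F
  block₁₀↠block₇ 7F = 4F
  block₁₀↠block₇ 8F = 5F
  block₁₀↠block₇ 9F = 6F
  block₇↣block₁₀ : Fin 7 → Fin 10
  block₇↣block₁₀ 0F = 0F
  block₇↣block₁₀ 1F = 1F
  block₇↣block₁₀ 2F = 2F
  block₇↣block₁₀ 3F = 6F
  block₇↣block₁₀ 4F = 7F
  block₇↣block₁₀ 5F = 8F
  block₇↣block₁₀ 6F = 9F

α₁₂₄⊨twoCycle : Models α₁₂₄ twoCycleSentence
α₁₂₄⊨twoCycle = blockPerm-twoCycle cycles-1-2-4 marked 1F refl
  (from-yes (all? λ r → (marked (cycles-1-2-4 ⟨$⟩ˡ r) ∧ marked r) ≟ᵇ false))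
  (from-yes (all? λ r → (marked r ≟ᵇ true) →-dec (cycles-1-2-4 ⟨$⟩ˡ (cycles-1-2-4 ⟨$⟩ˡ r) ≟ r)))
  where
  marked : Fin 7 → Bool
  marked 1F = true
  marked _  = false

α₁₄⊭twoCycle : ¬ Models α₁₄ twoCycleSentence
α₁₄⊭twoCycle = blockPerm-¬twoCycle cycles-1-4 colour
  (from-yes (all? λ r → (cycles-1-4 ⟨$⟩ˡ r ≟ r)
                        ⊎-dec (colour (cycles-1-4 ⟨$⟩ˡ (cycles-1-4 ⟨$⟩ˡ r)) ≟ᵇ not (colour r))))
  where
  colour : Fin 5 → Bool
  colour 1F = true
  colour 2F = true
  colour _  = false

corollary5p6 : ExcludedMiddle 0ℓ →
    Σ AlmostPerm λ f → Σ AlmostPerm λ g →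
      BiEmbeddable f g × ¬ SameTheory f g
corollary5p6 _ = α₁₄ , α₁₂₄ , (α₁₄↪α₁₂₄ , α₁₂₄↪α₁₄) ,
  λ same → α₁₄⊭twoCycle (Equivalence.from (same twoCycleSentence) α₁₂₄⊨twoCycle)
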